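{- Let $t \ge 2$ be an integer and let $a \in \left(\tfrac{1}{2}, 1\right)$ be a fixed real number. Then, as $n \to \infty$, $$\mathrm{ex}\left(n, n^a, \{C_4, \theta_{3,t}\}\right) \le \left(\sqrt[3]{t-1} + o(1)\right) n^{(2+2a)/3}.$$
   Context: For positive integers $n, m$ and a family $\mathcal{F}$ of graphs, the bipartite Turán number $\mathrm{ex}(n,m,\mathcal{F})$ is the maximum number of edges in a bipartite graph with parts of sizes $m$ and $n$ that contains no graph of $\mathcal{F}$ as a subgraph. $C_4$ is the cycle of length $4$, and $\theta_{3,t}$ is the graph consisting of two vertices joined by $t$ internally vertex-disjoint paths, each of length $3$. -}

module Defs where

open import Data.Nat using (ℕ; zero; suc; _≤_; _<_; _^_)
open import Data.Nat as ℕ using ()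
open import Data.Integer using (+_)
open import Data.Rational using (ℚ; _/_; ½; 1ℚ)
open import Data.Rational as ℚ using ()
open import Data.Fin using (Fin)
open import Data.Bool using (Bool; T; if_then_else_)
open import Data.List using (List; map; allFin)
open import Data.Nat.ListAction using (sum)
open import Data.Sum using (_⊎_; inj₁; inj₂)
open import Data.Product using (_×_; ∃; Σ; _,_)
open import Data.Empty using (⊥)
open import Relation.Binary.PropositionalEquality using (_≡_)
open import Function.Definitions using (Injective)

record Real : Set₁ where
  field
    L U         : ℚ → Set
    L-inhabited : ∃ L
    U-inhabited : ∃ U
    L-rounded₁  : ∀ q → L q → ∃ λ r → q ℚ.< r × L r
    L-rounded₂  : ∀ q r → q ℚ.< r → L r → L q
    U-rounded₁  : ∀ r → U r → ∃ λ q → q ℚ.< r × U q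
    U-rounded₂  : ∀ q r → q ℚ.< r → U q → U r
    disjoint    : ∀ q → L q → U q → ⊥
    located     : ∀ q r → q ℚ.< r → L q ⊎ U r

open Real public

InHalfOne : Real → Set
InHalfOne a = L a ½ × U a 1ℚ

-- IsFloorPow a n m  :⇔  m = ⌊ n ^ a ⌋, i.e. m ≤ n^a < m + 1
-- (written through the rational upper cut of a; meaningful for n ≥ 2, a > 0):
--   m ≤ n^a      ⇔  for all rationals p/q > a :  m^q < n^p
--   n^a < m + 1  ⇔  for some rational p/q > a :  n^p < (m+1)^q
IsFloorPow : Real → ℕ → ℕ → Set
IsFloorPow a n m =
  (∀ p q → U a (+ p / suc q) → m ^ suc q < n ^ p)
  × (∃ λ p → ∃ λ q → U a (+ p / suc q) × n ^ p < suc m ^ suc q)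

BipGraph : ℕ → ℕ → Set
BipGraph m n = Fin m → Fin n → Bool

Adj : ∀ {m n} → BipGraph m n → Fin m ⊎ Fin n → Fin m ⊎ Fin n → Set
Adj G (inj₁ i) (inj₂ j) = T (G i j)
Adj G (inj₂ j) (inj₁ i) = T (G i j)
Adj G (inj₁ _) (inj₁ _) = ⊥
Adj G (inj₂ _) (inj₂ _) = ⊥

edges : ∀ {m n} → BipGraph m n → ℕ
edges {m} {n} G =
  sum (map (λ i → sum (map (λ j → if G i j then 1 else 0) (allFin n))) (allFin m))

-- A (pattern) graph: a vertex type and an edge relation
-- (each edge listed at least once; adjacency in G is symmetric).
record Pattern : Set₁ where
  field
    V : Set
    E : V → V → Set

open Pattern public

Contains : ∀ {m n} → BipGraph m n → Pattern → Set
Contains {m} {n} G H =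
  Σ (V H → Fin m ⊎ Fin n) λ f →
    Injective _≡_ _≡_ f × (∀ u v → E H u v → Adj G (f u) (f v))

data C4V : Set where
  c0 c1 c2 c3 : C4V

data C4E : C4V → C4V → Set where
  e01 : C4E c0 c1
  e12 : C4E c1 c2
  e23 : C4E c2 c3
  e30 : C4E c3 c0

C4 : Pattern
C4 = record { V = C4V ; E = C4E }

data ThetaV (t : ℕ) : Set where
  x y : ThetaV t
  u w : Fin t → ThetaV t

data ThetaE (t : ℕ) : ThetaV t → ThetaV t → Set where
  e-xu : ∀ i → ThetaE t x (u i)
  e-uw : ∀ i → ThetaE t (u i) (w i)
  e-wy : ∀ i → ThetaE t (w i) y

θ₃ : ℕ → Pattern
θ₃ t = record { V = ThetaV t ; E = ThetaE t }

{-# OPTIONS --safe #-}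
-- The paths a – j – i – b of length three with a ≠ i and j ≠ b are counted by the sum, over the
-- edges ij, of (deg j − 1)(deg i − 1). In a C4-free graph t such paths with the same ends a, b
-- have distinct inner vertices and form a θ(3,t), so this sum is at most (t − 1)nm. On the other
-- hand AM–GM for nm·deg i·deg j, e³/(n·deg j) and e³/(m·deg i), whose product is e⁶, bounds 3e²
-- on every edge, and over all edges the last two terms add up to e³ each; keeping track of the
-- corrections (the −1's and rounding the quotients up) gives
--   e³ ≤ (t − 1)n²m² + 3e²(n + m) + 2e.
-- As a < 1, m ≤ n; as a > 1/2, n = o(m²). So for e ≥ 7n(1 + (k + 1)(t − 1)) the error term is
-- absorbed by the slack 1/(k + 1), and for smaller e already e³ = O(n³) = o(n²m²).
module Submission where

open import Defs
open import Data.Nat using (ℕ; suc; _≤_; _*_; _+_; _∸_; _^_)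
open import Data.Product using (∃)
open import Relation.Nullary using (¬_)

open import Data.Bool using (Bool; true; false; T; if_then_else_; _∧_)
open import Data.Bool.Properties using (T-∧; ∧-identityʳ)
open import Data.Fin using (Fin; zero; suc; _≟_)
open import Data.Fin.Properties using (nonZeroIndex)
import Data.Integer as ℤ
open import Data.Integer.Properties using (pos-*; drop‿+<+)
open import Data.List using (List; []; _∷_; _++_; map; tabulate; allFin; cartesianProduct)
open import Data.List.Membership.Propositional using (_∈_)
open import Data.List.Properties using (map-tabulate; map-++; map-∘; map-cong)
import Data.List.Relation.Unary.All as All
open import Data.List.Relation.Unary.Any using (here; there)
open import Data.List.Relation.Unary.Unique.Propositional using (Unique; []; _∷_)
open import Data.List.Relation.Unary.Unique.Propositional.Properties using (cartesianProduct⁺; allFin⁺)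
open import Data.Nat using (zero; _<_; z≤n; s≤s; NonZero; >-nonZero)
open import Data.Nat.DivMod using (_/_; _%_; m≡m%n+[m/n]*n; m%n<n; m/n*n≤m)
import Data.Nat.ListAction as ListAction
open import Data.Nat.ListAction.Properties using (sum-++)
open import Data.Nat.Properties hiding (_≟_)
open import Algebra.Properties.CommutativeSemigroup *-commutativeSemigroup using (x∙yz≈y∙xz; x∙yz≈z∙xy)
open import Algebra.Properties.Semiring.Sum +-*-semiring
  using (sum; sum-syntax; sum-cong-≗; sum-replicate-zero; ∑-distrib-+; ∑-comm; *-distribˡ-sum; *-distribʳ-sum)
open import Data.Nat.Tactic.RingSolver using (solve-∀)
open import Data.Product using (Σ; _×_; _,_; proj₁; proj₂; uncurry)
open import Data.Rational as ℚ using (mkℚ; ½; 1ℚ)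
open import Data.Rational.Properties as ℚ using (toℚᵘ-mono-<; toℚᵘ-fromℚᵘ)
open import Data.Rational.Unnormalised using (mkℚᵘ; *<*)
open import Data.Rational.Unnormalised.Properties using (<-respʳ-≃)
open import Data.Sum using (_⊎_; inj₁; inj₂)
open import Data.Sum.Properties using (inj₁-injective; inj₂-injective)
import Data.Vec.Functional as Vector
open import Function using (_∘_; _$_; id)
open import Function.Bundles using (Equivalence)
open import Function.Definitions using (Injective)
open import Relation.Binary.Definitions using (tri<; tri≈; tri>)
open import Relation.Binary.PropositionalEquality
open import Relation.Nullary using (does; yes; no; contradiction)
open import Relation.Nullary.Decidable using (isNo; toWitnessFalse)

⟦_⟧ : Bool → ℕ
⟦ b ⟧ = if b then 1 else 0

⟦∧⟧ : ∀ p q → ⟦ p ∧ q ⟧ ≡ ⟦ p ⟧ * ⟦ q ⟧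
⟦∧⟧ true  q = sym (+-identityʳ ⟦ q ⟧)
⟦∧⟧ false q = refl

⟦≤1⟧ : ∀ b → ⟦ b ⟧ ≤ 1
⟦≤1⟧ true  = ≤-refl
⟦≤1⟧ false = z≤n

_≢?_ : ∀ {k} → Fin k → Fin k → Bool
a ≢? b = isNo (a ≟ b)

∑-mono-≤ : ∀ {n} {f g : Fin n → ℕ} → (∀ i → f i ≤ g i) → sum f ≤ sum g
∑-mono-≤ {zero}  f≤g = z≤n
∑-mono-≤ {suc n} f≤g = +-mono-≤ (f≤g zero) (∑-mono-≤ (f≤g ∘ suc))

≤-∑ : ∀ {n} (f : Fin n → ℕ) i → f i ≤ sum f
≤-∑ f zero    = m≤m+n (f zero) _
≤-∑ f (suc i) = ≤-trans (≤-∑ (f ∘ suc) i) (m≤n+m _ (f zero))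

∑-const : ∀ n c → ∑[ i < n ] c ≡ n * c
∑-const zero    c = refl
∑-const (suc n) c = cong (c +_) (∑-const n c)

∑-cancelˡ-≤ : ∀ n (f : Fin n → ℕ) c → n * sum f ≤ n * c → sum f ≤ c
∑-cancelˡ-≤ zero    f c _  = z≤n
∑-cancelˡ-≤ (suc n) f c le = *-cancelˡ-≤ (suc n) le

∑-indicator-≟ : ∀ {n} (j : Fin n) → ∑[ i < n ] ⟦ does (i ≟ j) ⟧ ≡ 1
∑-indicator-≟ {suc n} zero    = cong suc (sum-replicate-zero n)
∑-indicator-≟ {suc n} (suc j) = ∑-indicator-≟ j

∑⟦⟧≤1+∑⟦∧≢?⟧ : ∀ {k} (f : Fin k → Bool) i → ∑[ a < k ] ⟦ f a ⟧ ≤ 1 + ∑[ a < k ] ⟦ f a ∧ a ≢? i ⟧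
∑⟦⟧≤1+∑⟦∧≢?⟧ {k} f i = begin
  ∑[ a < k ] ⟦ f a ⟧                                             ≤⟨ ∑-mono-≤ split ⟩
  ∑[ a < k ] (⟦ does (a ≟ i) ⟧ + ⟦ f a ∧ a ≢? i ⟧)               ≡⟨ ∑-distrib-+ (λ a → ⟦ does (a ≟ i) ⟧) others ⟩
  ∑[ a < k ] ⟦ does (a ≟ i) ⟧ + sum others                       ≡⟨ cong (_+ sum others) (∑-indicator-≟ i) ⟩
  1 + ∑[ a < k ] ⟦ f a ∧ a ≢? i ⟧                                ∎
  where
  open ≤-Reasoning
  others : Fin k → ℕ
  others a = ⟦ f a ∧ a ≢? i ⟧
  split : ∀ a → ⟦ f a ⟧ ≤ ⟦ does (a ≟ i) ⟧ + ⟦ f a ∧ a ≢? i ⟧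
  split a with a ≟ i
  ... | yes _ = ≤-trans (⟦≤1⟧ (f a)) (m≤m+n 1 _)
  ... | no  _ = ≤-reflexive (cong ⟦_⟧ (sym (∧-identityʳ (f a))))

∑*∑ : ∀ {k l} (f : Fin k → ℕ) (g : Fin l → ℕ) → sum f * sum g ≡ ∑[ a < k ] ∑[ b < l ] (f a * g b)
∑*∑ f g = trans (*-distribʳ-sum (sum g) f) (sum-cong-≗ λ a → *-distribˡ-sum (f a) g)

*-distribˡ-+₃ : ∀ a b c d → a * (b + c + d) ≡ a * b + a * c + a * d
*-distribˡ-+₃ a b c d = trans (*-distribˡ-+ a (b + c) d) (cong (_+ a * d) (*-distribˡ-+ a b c))

∑-distrib-+₃ : ∀ {k} (f g h : Fin k → ℕ) → ∑[ i < k ] (f i + g i + h i) ≡ sum f + sum g + sum h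
∑-distrib-+₃ f g h = trans (∑-distrib-+ (λ i → f i + g i) h) (cong (_+ sum h) (∑-distrib-+ f g))

∑²-distrib-+₃ : ∀ {k l} (f g h : Fin k → Fin l → ℕ) →
                ∑[ i < k ] ∑[ j < l ] (f i j + g i j + h i j) ≡
                ∑[ i < k ] ∑[ j < l ] f i j + ∑[ i < k ] ∑[ j < l ] g i j + ∑[ i < k ] ∑[ j < l ] h i j
∑²-distrib-+₃ f g h = trans (sum-cong-≗ λ i → ∑-distrib-+₃ (f i) (g i) (h i))
                            (∑-distrib-+₃ (sum ∘ f) (sum ∘ g) (sum ∘ h))

∑²-comm : ∀ {k l k′ l′} (h : Fin k → Fin l → Fin k′ → Fin l′ → ℕ) →
          ∑[ i < k ] ∑[ j < l ] ∑[ a < k′ ] ∑[ b < l′ ] h i j a b ≡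
          ∑[ a < k′ ] ∑[ b < l′ ] ∑[ i < k ] ∑[ j < l ] h i j a b
∑²-comm {k} {l} {k′} {l′} h = begin
  ∑[ i < k ] ∑[ j < l ] ∑[ a < k′ ] ∑[ b < l′ ] h i j a b
    ≡⟨ sum-cong-≗ (λ i → ∑-comm (λ j a → ∑[ b < l′ ] h i j a b)) ⟩
  ∑[ i < k ] ∑[ a < k′ ] ∑[ j < l ] ∑[ b < l′ ] h i j a b
    ≡⟨ ∑-comm (λ i a → ∑[ j < l ] ∑[ b < l′ ] h i j a b) ⟩
  ∑[ a < k′ ] ∑[ i < k ] ∑[ j < l ] ∑[ b < l′ ] h i j a b
    ≡⟨ sum-cong-≗ (λ a → sum-cong-≗ (λ i → ∑-comm (λ j b → h i j a b))) ⟩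
  ∑[ a < k′ ] ∑[ i < k ] ∑[ b < l′ ] ∑[ j < l ] h i j a b
    ≡⟨ sum-cong-≗ (λ a → ∑-comm (λ i b → ∑[ j < l ] h i j a b)) ⟩
  ∑[ a < k′ ] ∑[ b < l′ ] ∑[ i < k ] ∑[ j < l ] h i j a b ∎
  where open ≡-Reasoning

sum-tabulate : ∀ {n} (f : Fin n → ℕ) → ListAction.sum (tabulate f) ≡ sum f
sum-tabulate {zero}  f = refl
sum-tabulate {suc n} f = cong (f zero +_) (sum-tabulate (f ∘ suc))

sum-map-allFin : ∀ n (f : Fin n → ℕ) → ListAction.sum (map f (allFin n)) ≡ sum f
sum-map-allFin n f = trans (cong ListAction.sum (map-tabulate id f)) (sum-tabulate f)

sum-map-cartesianProduct : ∀ {A B : Set} (h : A × B → ℕ) (xs : List A) (ys : List B) →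
  ListAction.sum (map h (cartesianProduct xs ys)) ≡
  ListAction.sum (map (λ a → ListAction.sum (map (λ b → h (a , b)) ys)) xs)
sum-map-cartesianProduct h []       ys = refl
sum-map-cartesianProduct h (a ∷ xs) ys = begin
  ListAction.sum (map h (map (a ,_) ys ++ cartesianProduct xs ys))
    ≡⟨ cong ListAction.sum (map-++ h (map (a ,_) ys) _) ⟩
  ListAction.sum (map h (map (a ,_) ys) ++ map h (cartesianProduct xs ys))
    ≡⟨ sum-++ (map h (map (a ,_) ys)) _ ⟩
  ListAction.sum (map h (map (a ,_) ys)) + ListAction.sum (map h (cartesianProduct xs ys))
    ≡⟨ cong₂ _+_ (cong ListAction.sum (sym (map-∘ ys))) (sum-map-cartesianProduct h xs ys) ⟩
  _ ∎
  where open ≡-Reasoning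

sum-map-allPairs : ∀ m n (h : Fin m × Fin n → ℕ) →
  ListAction.sum (map h (cartesianProduct (allFin m) (allFin n))) ≡ ∑[ i < m ] ∑[ j < n ] h (i , j)
sum-map-allPairs m n h = begin
  ListAction.sum (map h (cartesianProduct (allFin m) (allFin n)))
    ≡⟨ sum-map-cartesianProduct h (allFin m) (allFin n) ⟩
  ListAction.sum (map (λ i → ListAction.sum (map (λ j → h (i , j)) (allFin n))) (allFin m))
    ≡⟨ sum-map-allFin m _ ⟩
  ∑[ i < m ] ListAction.sum (map (λ j → h (i , j)) (allFin n))
    ≡⟨ sum-cong-≗ (λ i → sum-map-allFin n (λ j → h (i , j))) ⟩
  ∑[ i < m ] ∑[ j < n ] h (i , j) ∎
  where open ≡-Reasoning

-- Not the exact ceiling of c / k (it overshoots by one when k ∣ c), and 0 for k = 0: only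
-- c ≤ upperQuotient c k * k ≤ c + k is used.
upperQuotient : ℕ → ℕ → ℕ
upperQuotient c zero        = 0
upperQuotient c k@(suc _)   = c / k + 1

≤-upperQuotient : ∀ c k .{{_ : NonZero k}} → c ≤ upperQuotient c k * k
≤-upperQuotient c k@(suc _) = begin
  c                    ≡⟨ m≡m%n+[m/n]*n c k ⟩
  c % k + c / k * k    ≤⟨ +-monoˡ-≤ (c / k * k) (<⇒≤ (m%n<n c k)) ⟩
  k + c / k * k        ≡⟨ +-comm k (c / k * k) ⟩
  c / k * k + k        ≡⟨ cong (c / k * k +_) (*-identityˡ k) ⟨
  c / k * k + 1 * k    ≡⟨ *-distribʳ-+ k (c / k) 1 ⟨
  (c / k + 1) * k      ∎
  where open ≤-Reasoning

upperQuotient*≤ : ∀ c k → upperQuotient c k * k ≤ c + k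
upperQuotient*≤ c zero      = z≤n
upperQuotient*≤ c k@(suc _) = begin
  (c / k + 1) * k      ≡⟨ *-distribʳ-+ k (c / k) 1 ⟩
  c / k * k + 1 * k    ≤⟨ +-monoˡ-≤ (1 * k) (m/n*n≤m c k) ⟩
  c + 1 * k            ≡⟨ cong (c +_) (*-identityˡ k) ⟩
  c + k                ∎
  where open ≤-Reasoning

∑-weighted-upperQuotient : ∀ n (d : Fin n → ℕ) c →
                           ∑[ j < n ] (d j * upperQuotient c (n * d j)) ≤ c + sum d
∑-weighted-upperQuotient n d c = ∑-cancelˡ-≤ n _ _ $ begin
  n * ∑[ j < n ] (d j * q j)         ≡⟨ *-distribˡ-sum n (λ j → d j * q j) ⟩
  ∑[ j < n ] (n * (d j * q j))       ≡⟨ sum-cong-≗ (λ j → x∙yz≈z∙xy n (d j) (q j)) ⟩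
  ∑[ j < n ] (q j * (n * d j))       ≤⟨ ∑-mono-≤ (λ j → upperQuotient*≤ c (n * d j)) ⟩
  ∑[ j < n ] (c + n * d j)           ≡⟨ ∑-distrib-+ (λ _ → c) (λ j → n * d j) ⟩
  ∑[ j < n ] c + ∑[ j < n ] (n * d j) ≡⟨ cong₂ _+_ (∑-const n c) (sym (*-distribˡ-sum n d)) ⟩
  n * c + n * sum d                  ≡⟨ *-distribˡ-+ n c (sum d) ⟨
  n * (c + sum d)                    ∎
  where
  open ≤-Reasoning
  q : Fin n → ℕ
  q j = upperQuotient c (n * d j)

module _ {A : Set} (P : A → Bool) where

  count : List A → ℕ
  count xs = ListAction.sum (map (⟦_⟧ ∘ P) xs)

  DistinctWitnesses : ℕ → List A → Set
  DistinctWitnesses t xs =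
    Σ (Fin t → A) λ f → Injective _≡_ _≡_ f × (∀ k → T (P (f k))) × (∀ k → f k ∈ xs)

  no-witnesses : ∀ {xs} → DistinctWitnesses 0 xs
  no-witnesses = (λ ()) , (λ { {()} }) , (λ ()) , (λ ())

  distinctWitnesses : ∀ {xs} → Unique xs → ∀ t → t ≤ count xs → DistinctWitnesses t xs
  distinctWitnesses []                .zero z≤n = no-witnesses
  distinctWitnesses {a ∷ xs} (a∉xs ∷ uniq) t t≤ with P a in Px
  ... | false = let f , f-inj , Pf , f∈ = distinctWitnesses uniq t t≤ in f , f-inj , Pf , there ∘ f∈
  ... | true with t
  ...   | zero  = no-witnesses
  ...   | suc s = let f , f-inj , Pf , f∈ = distinctWitnesses uniq s (≤-pred t≤) in
                  (a Vector.∷ f) , cons-injective f-inj f∈ , cons-P Pf , cons-∈ f∈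
    where
    cons-injective : ∀ {f : Fin s → A} → Injective _≡_ _≡_ f → (∀ k → f k ∈ xs) → Injective _≡_ _≡_ (a Vector.∷ f)
    cons-injective f-inj f∈ {zero}  {zero}  _  = refl
    cons-injective f-inj f∈ {zero}  {suc l} eq = contradiction eq (All.lookup a∉xs (f∈ l))
    cons-injective f-inj f∈ {suc k} {zero}  eq = contradiction (sym eq) (All.lookup a∉xs (f∈ k))
    cons-injective f-inj f∈ {suc k} {suc l} eq = cong suc (f-inj eq)
    cons-P : ∀ {f : Fin s → A} → (∀ k → T (P (f k))) → ∀ k → T (P ((a Vector.∷ f) k))
    cons-P Pf zero    = subst T (sym Px) _
    cons-P Pf (suc k) = Pf k
    cons-∈ : ∀ {f : Fin s → A} → (∀ k → f k ∈ xs) → ∀ k → (a Vector.∷ f) k ∈ a ∷ xs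
    cons-∈ f∈ zero    = here refl
    cons-∈ f∈ (suc k) = there (f∈ k)

m+o≡n⇒m≤n : ∀ {m n} o → m + o ≡ n → m ≤ n
m+o≡n⇒m≤n o refl = m≤m+n _ o

^-distribʳ-* : ∀ a b k → (a * b) ^ k ≡ a ^ k * b ^ k
^-distribʳ-* a b zero    = refl
^-distribʳ-* a b (suc k) = trans (cong (a * b *_) (^-distribʳ-* a b k)) ([m*n]*[o*p]≡[m*o]*[n*p] a b _ _)

^-cancelˡ-< : ∀ k {a b} → a ^ k < b ^ k → a < b
^-cancelˡ-< k lt = ≰⇒> (<⇒≱ lt ∘ ^-monoˡ-≤ k)

^-cancelˡ-≤ : ∀ k .{{_ : NonZero k}} {a b} → a ^ k ≤ b ^ k → a ≤ b
^-cancelˡ-≤ k le = ≮⇒≥ (≤⇒≯ le ∘ ^-monoˡ-< k)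

am-gm₂ : ∀ a b → 4 * (a * b) ≤ (a + b) * (a + b)
am-gm₂ a b with ≤-total a b
... | inj₁ a≤b with c , refl ← m≤n⇒∃[o]m+o≡n a≤b = m+o≡n⇒m≤n (c * c) (identity a c)
  where
  identity : ∀ a c → 4 * (a * (a + c)) + c * c ≡ (a + (a + c)) * (a + (a + c))
  identity = solve-∀
... | inj₂ b≤a with c , refl ← m≤n⇒∃[o]m+o≡n b≤a = m+o≡n⇒m≤n (c * c) (identity b c)
  where
  identity : ∀ b c → 4 * ((b + c) * b) + c * c ≡ (b + c + b) * (b + c + b)
  identity = solve-∀

am-gm₃ : ∀ a b → 27 * (a * (b * b)) ≤ (a + 2 * b) * (a + 2 * b) * (a + 2 * b)
am-gm₃ a b with ≤-total a b
... | inj₁ a≤b with c , refl ← m≤n⇒∃[o]m+o≡n a≤b = m+o≡n⇒m≤n (c * c * (9 * a + 8 * c)) (identity a c)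
  where
  identity : ∀ a c → 27 * (a * ((a + c) * (a + c))) + c * c * (9 * a + 8 * c) ≡
                     (a + 2 * (a + c)) * (a + 2 * (a + c)) * (a + 2 * (a + c))
  identity = solve-∀
... | inj₂ b≤a with c , refl ← m≤n⇒∃[o]m+o≡n b≤a = m+o≡n⇒m≤n (c * c * (9 * b + c)) (identity b c)
  where
  identity : ∀ b c → 27 * ((b + c) * (b * b)) + c * c * (9 * b + c) ≡
                     (b + c + 2 * b) * (b + c + 2 * b) * (b + c + 2 * b)
  identity = solve-∀

P*D²≤4s³ : ∀ s P D → P + D ≡ 3 * s → P * (D * D) ≤ 4 * (s * s * s)
P*D²≤4s³ s P D P+D≡3s = *-cancelˡ-≤ 54 $ begin
  54 * (P * (D * D))                                   ≡⟨ lhs P D ⟩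
  27 * (2 * P * (D * D))                               ≤⟨ am-gm₃ (2 * P) D ⟩
  (2 * P + 2 * D) * (2 * P + 2 * D) * (2 * P + 2 * D)  ≡⟨ cong (λ z → z * z * z) (2P+2D≡6s P D s P+D≡3s) ⟩
  6 * s * (6 * s) * (6 * s)                            ≡⟨ rhs s ⟩
  54 * (4 * (s * s * s))                               ∎
  where
  open ≤-Reasoning
  lhs : ∀ P D → 54 * (P * (D * D)) ≡ 27 * (2 * P * (D * D))
  lhs = solve-∀
  rhs : ∀ s → 6 * s * (6 * s) * (6 * s) ≡ 54 * (4 * (s * s * s))
  rhs = solve-∀
  2P+2D≡6s : ∀ P D s → P + D ≡ 3 * s → 2 * P + 2 * D ≡ 6 * s
  2P+2D≡6s P D s eq = trans (sym (*-distribˡ-+ 2 P D)) (trans (cong (2 *_) eq) (sym (*-assoc 2 3 s)))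

-- AM–GM for ab, e³/a and e³/b, cleared of denominators.
3e²ab≤[ab]²+e³[a+b] : ∀ e a b → 3 * (e * e) * (a * b) ≤ (a * b) * (a * b) + e * e * e * (a + b)
3e²ab≤[ab]²+e³[a+b] e a b with 3 * (e * e) ≤? a * b
... | yes 3e²≤ab = ≤-trans (*-monoˡ-≤ (a * b) 3e²≤ab) (m≤m+n _ _)
... | no  3e²≰ab = begin
  3 * s * P          ≡⟨ cong (_* P) (sym P+D≡3s) ⟩
  (P + D) * P        ≡⟨ *-distribʳ-+ P P D ⟩
  P * P + D * P      ≡⟨ cong (P * P +_) (*-comm D P) ⟩
  P * P + P * D      ≤⟨ +-monoʳ-≤ (P * P) (^-cancelˡ-≤ 2 [PD]²≤[e³[a+b]]²) ⟩
  P * P + e * e * e * (a + b) ∎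
  where
  open ≤-Reasoning
  s : ℕ
  s = e * e
  P : ℕ
  P = a * b
  D : ℕ
  D = 3 * s ∸ P
  P+D≡3s : P + D ≡ 3 * s
  P+D≡3s = m+[n∸m]≡n (<⇒≤ (≰⇒> 3e²≰ab))
  [PD]²≤[e³[a+b]]² : (P * D) ^ 2 ≤ (e * e * e * (a + b)) ^ 2
  [PD]²≤[e³[a+b]]² = begin
    (P * D) ^ 2                       ≡⟨ expand₁ P D ⟩
    P * (P * (D * D))                 ≤⟨ *-monoʳ-≤ P (P*D²≤4s³ s P D P+D≡3s) ⟩
    P * (4 * (s * s * s))             ≡⟨ expand₂ a b s ⟩
    s * s * s * (4 * (a * b))         ≤⟨ *-monoʳ-≤ (s * s * s) (am-gm₂ a b) ⟩
    s * s * s * ((a + b) * (a + b))   ≡⟨ expand₃ e (a + b) ⟩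
    (e * e * e * (a + b)) ^ 2         ∎
    where
    -- The ring solver does not handle _^_, so identities involving x ^ 2 state it as x * (x * 1).
    expand₁ : ∀ P D → P * D * (P * D * 1) ≡ P * (P * (D * D))
    expand₁ = solve-∀
    expand₂ : ∀ a b s → a * b * (4 * (s * s * s)) ≡ s * s * s * (4 * (a * b))
    expand₂ = solve-∀
    expand₃ : ∀ e z → e * e * (e * e) * (e * e) * (z * z) ≡ e * e * e * z * (e * e * e * z * 1)
    expand₃ = solve-∀

3e²z≤z[ab]+e³[a+b] : ∀ e a b z → .{{_ : NonZero (a * b)}} → z ≤ a * b →
               3 * (e * e) * z ≤ z * (a * b) + e * e * e * (a + b)
3e²z≤z[ab]+e³[a+b] e a b z z≤ab = *-cancelˡ-≤ (a * b) $ begin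
  a * b * (3 * (e * e) * z)            ≡⟨ reorder₁ a b e z ⟩
  z * (3 * (e * e) * (a * b))          ≤⟨ *-monoʳ-≤ z (3e²ab≤[ab]²+e³[a+b] e a b) ⟩
  z * (a * b * (a * b) + Q)            ≡⟨ *-distribˡ-+ z _ Q ⟩
  z * (a * b * (a * b)) + z * Q        ≤⟨ +-monoʳ-≤ (z * (a * b * (a * b))) (*-monoˡ-≤ Q z≤ab) ⟩
  z * (a * b * (a * b)) + a * b * Q    ≡⟨ reorder₂ (a * b) z Q ⟩
  a * b * (z * (a * b) + Q)            ∎
  where
  open ≤-Reasoning
  Q : ℕ
  Q = e * e * e * (a + b)
  reorder₁ : ∀ a b e z → a * b * (3 * (e * e) * z) ≡ z * (3 * (e * e) * (a * b))
  reorder₁ = solve-∀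
  reorder₂ : ∀ p z Q → z * (p * p) + p * Q ≡ p * (z * p + Q)
  reorder₂ = solve-∀

per-edge-am-gm : ∀ n m e a b F H → .{{_ : NonZero n}} → .{{_ : NonZero m}} →
                 e * e * (e + 3 * n) ≤ F * (n * suc a) → e * e * (e + 3 * m) ≤ H * (m * suc b) →
                 3 * (e * e) ≤ n * m * (a * b) + F + H
per-edge-am-gm n m e a b F H bound-F bound-H = *-cancelˡ-≤ (X * Y) {{XY≢0}} $ begin
  X * Y * (3 * (e * e))                                   ≡⟨ *-comm (X * Y) _ ⟩
  3 * (e * e) * (X * Y)                                   ≤⟨ *-monoʳ-≤ (3 * (e * e)) XY≤Z+mX+nY ⟩
  3 * (e * e) * (Z + (m * X + n * Y))                     ≡⟨ *-distribˡ-+ (3 * (e * e)) Z _ ⟩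
  3 * (e * e) * Z + 3 * (e * e) * (m * X + n * Y)         ≤⟨ +-monoˡ-≤ _ (3e²z≤z[ab]+e³[a+b] e X Y Z {{XY≢0}} Z≤XY) ⟩
  Z * (X * Y) + e * e * e * (X + Y) + 3 * (e * e) * (m * X + n * Y)
    ≡⟨ regroup Z X Y e n m ⟩
  X * Y * Z + (Y * (e * e * (e + 3 * n)) + X * (e * e * (e + 3 * m)))
    ≤⟨ +-monoʳ-≤ (X * Y * Z) (+-mono-≤ (*-monoʳ-≤ Y bound-F) (*-monoʳ-≤ X bound-H)) ⟩
  X * Y * Z + (Y * (F * X) + X * (H * Y))                 ≡⟨ factor X Y Z F H ⟩
  X * Y * (Z + F + H)                                     ∎
  where
  open ≤-Reasoning
  X : ℕ
  X = n * suc a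
  Y : ℕ
  Y = m * suc b
  Z : ℕ
  Z = n * m * (a * b)
  XY≢0 : NonZero (X * Y)
  XY≢0 = m*n≢0 X Y {{m*n≢0 n (suc a)}} {{m*n≢0 m (suc b)}}
  Z≤XY : Z ≤ X * Y
  Z≤XY = m+o≡n⇒m≤n (n * m * (a + b + 1)) (identity n m a b)
    where
    identity : ∀ n m a b → n * m * (a * b) + n * m * (a + b + 1) ≡ n * suc a * (m * suc b)
    identity = solve-∀
  XY≤Z+mX+nY : X * Y ≤ Z + (m * X + n * Y)
  XY≤Z+mX+nY = m+o≡n⇒m≤n (n * m) (identity n m a b)
    where
    identity : ∀ n m a b → n * suc a * (m * suc b) + n * m ≡ n * m * (a * b) + (m * (n * suc a) + n * (m * suc b))
    identity = solve-∀
  regroup : ∀ Z X Y e n m → Z * (X * Y) + e * e * e * (X + Y) + 3 * (e * e) * (m * X + n * Y) ≡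
            X * Y * Z + (Y * (e * e * (e + 3 * n)) + X * (e * e * (e + 3 * m)))
  regroup = solve-∀
  factor : ∀ X Y Z F H → X * Y * Z + (Y * (F * X) + X * (H * Y)) ≡ X * Y * (Z + F + H)
  factor = solve-∀

absorb-lower-order : ∀ K T X D e → .{{_ : NonZero T}} →
                     e ^ 3 ≤ T * X + D * e ^ 2 → K * (D * (K * T + 1)) ^ 3 ≤ (K * T + 1) * X →
                     K * e ^ 3 ≤ (K * T + 1) * X
absorb-lower-order K T X D e e³≤ small-case with D * (K * T + 1) ≤? e
... | no  DB≰e = ≤-trans (*-monoʳ-≤ K (^-monoˡ-≤ 3 (<⇒≤ (≰⇒> DB≰e)))) small-case
... | yes DB≤e = *-cancelˡ-≤ T $ +-cancelʳ-≤ (e ^ 3) _ _ $ begin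
  T * (K * e ^ 3) + e ^ 3       ≡⟨ expand T K (e ^ 3) ⟩
  B * e ^ 3                     ≤⟨ *-monoʳ-≤ B e³≤ ⟩
  B * (T * X + D * e ^ 2)       ≡⟨ regroup B T X D (e ^ 2) ⟩
  T * (B * X) + D * B * e ^ 2   ≤⟨ +-monoʳ-≤ (T * (B * X)) (*-monoˡ-≤ (e ^ 2) DB≤e) ⟩
  T * (B * X) + e ^ 3           ∎
  where
  open ≤-Reasoning
  B : ℕ
  B = K * T + 1
  expand : ∀ T K E → T * (K * E) + E ≡ (K * T + 1) * E
  expand = solve-∀
  regroup : ∀ B T X D E → B * (T * X + D * E) ≡ T * (B * X) + D * B * E
  regroup = solve-∀

lower-order-terms : ∀ n m e T → m ≤ n → 2 ≤ n →
                    e * e * e ≤ T * (n * n * (m * m)) + 3 * (e * e) * (n + m) + 2 * e →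
                    e ^ 3 ≤ T * (n ^ 2 * m ^ 2) + 7 * n * e ^ 2
lower-order-terms n m e T m≤n 2≤n e³≤ = begin
  e ^ 3                                                     ≡⟨ cube e ⟩
  e * e * e                                                 ≤⟨ e³≤ ⟩
  T * (n * n * (m * m)) + 3 * (e * e) * (n + m) + 2 * e
    ≤⟨ +-mono-≤ (+-monoʳ-≤ (T * (n * n * (m * m))) (*-monoʳ-≤ (3 * (e * e)) (+-monoʳ-≤ n m≤n))) (2e≤ne² e) ⟩
  T * (n * n * (m * m)) + 3 * (e * e) * (n + n) + n * (e * e) ≡⟨ collect n m e T ⟩
  T * (n ^ 2 * m ^ 2) + 7 * n * e ^ 2                       ∎
  where
  open ≤-Reasoning
  cube : ∀ e → e * (e * (e * 1)) ≡ e * e * e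
  cube = solve-∀
  collect : ∀ n m e T → T * (n * n * (m * m)) + 3 * (e * e) * (n + n) + n * (e * e) ≡
                        T * (n * (n * 1) * (m * (m * 1))) + 7 * n * (e * (e * 1))
  collect = solve-∀
  2e≤ne² : ∀ e → 2 * e ≤ n * (e * e)
  2e≤ne² zero      = z≤n
  2e≤ne² e@(suc _) = ≤-trans (*-monoˡ-≤ e 2≤n) (*-monoʳ-≤ n (m≤m*n e e))

-- Paths of length three in a C4-free bipartite graph

module _ {m n : ℕ} (G : BipGraph m n) where

  degA : Fin m → ℕ
  degA i = ∑[ j < n ] ⟦ G i j ⟧

  degB : Fin n → ℕ
  degB j = ∑[ i < m ] ⟦ G i j ⟧

  edges≡∑degA : edges G ≡ sum degA
  edges≡∑degA = trans (cong ListAction.sum (map-cong (λ i → sum-map-allFin n (λ j → ⟦ G i j ⟧)) (allFin m)))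
                      (sum-map-allFin m degA)

  ∑degB≡∑degA : sum degB ≡ sum degA
  ∑degB≡∑degA = sym (∑-comm (λ i j → ⟦ G i j ⟧))

  C4-of : ∀ {i i′ j j′} → i ≢ i′ → j ≢ j′ →
          T (G i j) → T (G i′ j) → T (G i′ j′) → T (G i j′) → Contains G C4
  C4-of {i} {i′} {j} {j′} i≢i′ j≢j′ ij i′j i′j′ ij′ = f , f-injective , f-edges
    where
    f : C4V → Fin m ⊎ Fin n
    f c0 = inj₁ i
    f c1 = inj₂ j
    f c2 = inj₁ i′
    f c3 = inj₂ j′
    f-injective : Injective _≡_ _≡_ f
    f-injective {c0} {c0} _  = refl
    f-injective {c1} {c1} _  = refl
    f-injective {c2} {c2} _  = refl
    f-injective {c3} {c3} _  = refl
    f-injective {c0} {c2} eq = contradiction (inj₁-injective eq) i≢i′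
    f-injective {c2} {c0} eq = contradiction (inj₁-injective (sym eq)) i≢i′
    f-injective {c1} {c3} eq = contradiction (inj₂-injective eq) j≢j′
    f-injective {c3} {c1} eq = contradiction (inj₂-injective (sym eq)) j≢j′
    f-injective {c0} {c1} ()
    f-injective {c0} {c3} ()
    f-injective {c1} {c0} ()
    f-injective {c1} {c2} ()
    f-injective {c2} {c1} ()
    f-injective {c2} {c3} ()
    f-injective {c3} {c0} ()
    f-injective {c3} {c2} ()
    f-edges : ∀ p q → C4E p q → Adj G (f p) (f q)
    f-edges _ _ e01 = ij
    f-edges _ _ e12 = i′j
    f-edges _ _ e23 = i′j′
    f-edges _ _ e30 = ij′

  two-common-neighbours⇒≡ᴬ : ¬ Contains G C4 → ∀ {i i′ j j′} → j ≢ j′ →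
                             T (G i j) → T (G i′ j) → T (G i′ j′) → T (G i j′) → i ≡ i′
  two-common-neighbours⇒≡ᴬ noC4 {i} {i′} j≢j′ ij i′j i′j′ ij′ with i ≟ i′
  ... | yes i≡i′ = i≡i′
  ... | no  i≢i′ = contradiction (C4-of i≢i′ j≢j′ ij i′j i′j′ ij′) noC4

  two-common-neighbours⇒≡ᴮ : ¬ Contains G C4 → ∀ {i i′ j j′} → i ≢ i′ →
                             T (G i j) → T (G i′ j) → T (G i′ j′) → T (G i j′) → j ≡ j′
  two-common-neighbours⇒≡ᴮ noC4 {j = j} {j′} i≢i′ ij i′j i′j′ ij′ with j ≟ j′
  ... | yes j≡j′ = j≡j′
  ... | no  j≢j′ = contradiction (C4-of i≢i′ j≢j′ ij i′j i′j′ ij′) noC4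

  record Path₃ (a : Fin m) (b : Fin n) (i : Fin m) (j : Fin n) : Set where
    field
      a-j : T (G a j)
      i-j : T (G i j)
      i-b : T (G i b)
      a≢i : a ≢ i
      b≢j : b ≢ j

  path₃? : Fin m → Fin n → Fin m → Fin n → Bool
  path₃? a b i j = G i j ∧ ((G a j ∧ a ≢? i) ∧ (G i b ∧ b ≢? j))

  path₃-sound : ∀ {a b i j} → T (path₃? a b i j) → Path₃ a b i j
  path₃-sound {a} {b} {i} {j} p =
    let i-j , rest = Equivalence.to (T-∧ {G i j}) p
        a-j∧a≢i , i-b∧b≢j = Equivalence.to (T-∧ {G a j ∧ a ≢? i}) rest
        a-j , a≢i = Equivalence.to (T-∧ {G a j}) a-j∧a≢i
        i-b , b≢j = Equivalence.to (T-∧ {G i b}) i-b∧b≢j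
    in record { a-j = a-j ; i-j = i-j ; i-b = i-b ; a≢i = toWitnessFalse a≢i ; b≢j = toWitnessFalse b≢j }

  θ₃-of-paths : ¬ Contains G C4 → ∀ {t a b} (p : Fin t → Fin m × Fin n) → Injective _≡_ _≡_ p →
                (∀ k → Path₃ a b (proj₁ (p k)) (proj₂ (p k))) → Contains G (θ₃ t)
  θ₃-of-paths noC4 {t} {a} {b} p p-injective path = f , f-injective , f-edges
    where
    i : Fin t → Fin m
    i = proj₁ ∘ p
    j : Fin t → Fin n
    j = proj₂ ∘ p
    open module path (k : Fin t) = Path₃ (path k)
    i≡-of-j≡ : ∀ {k l} → j k ≡ j l → i k ≡ i l
    i≡-of-j≡ {k} {l} jk≡jl = two-common-neighbours⇒≡ᴬ noC4 (≢-sym (b≢j k))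
      (i-j k) (subst (T ∘ G (i l)) (sym jk≡jl) (i-j l)) (i-b l) (i-b k)
    j≡-of-i≡ : ∀ {k l} → i k ≡ i l → j k ≡ j l
    j≡-of-i≡ {k} {l} ik≡il = two-common-neighbours⇒≡ᴮ noC4 (a≢i k)
      (a-j k) (i-j k) (subst (λ i′ → T (G i′ (j l))) (sym ik≡il) (i-j l)) (a-j l)
    f : ThetaV t → Fin m ⊎ Fin n
    f x     = inj₁ a
    f y     = inj₂ b
    f (u k) = inj₂ (j k)
    f (w k) = inj₁ (i k)
    f-injective : Injective _≡_ _≡_ f
    f-injective {x}   {x}   _  = refl
    f-injective {y}   {y}   _  = refl
    f-injective {u k} {u l} eq = cong u (p-injective (cong₂ _,_ (i≡-of-j≡ (inj₂-injective eq)) (inj₂-injective eq)))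
    f-injective {w k} {w l} eq = cong w (p-injective (cong₂ _,_ (inj₁-injective eq) (j≡-of-i≡ (inj₁-injective eq))))
    f-injective {x}   {w l} eq = contradiction (inj₁-injective eq) (a≢i l)
    f-injective {w k} {x}   eq = contradiction (inj₁-injective (sym eq)) (a≢i k)
    f-injective {y}   {u l} eq = contradiction (inj₂-injective eq) (b≢j l)
    f-injective {u k} {y}   eq = contradiction (inj₂-injective (sym eq)) (b≢j k)
    f-injective {x}   {y}   ()
    f-injective {x}   {u _} ()
    f-injective {y}   {x}   ()
    f-injective {y}   {w _} ()
    f-injective {u _} {x}   ()
    f-injective {u _} {w _} ()
    f-injective {w _} {y}   ()
    f-injective {w _} {u _} ()
    f-edges : ∀ p q → ThetaE t p q → Adj G (f p) (f q)
    f-edges _ _ (e-xu k) = a-j k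
    f-edges _ _ (e-uw k) = i-j k
    f-edges _ _ (e-wy k) = i-b k

  paths : Fin m → Fin n → ℕ
  paths a b = ∑[ i < m ] ∑[ j < n ] ⟦ path₃? a b i j ⟧

  paths<t : ¬ Contains G C4 → ∀ {t} → ¬ Contains G (θ₃ t) → ∀ a b → paths a b < t
  paths<t noC4 {t} noθ a b = ≰⇒> λ t≤paths →
    let p , p-injective , p-paths , _ =
          distinctWitnesses (uncurry (path₃? a b)) (cartesianProduct⁺ (allFin⁺ m) (allFin⁺ n)) t
            (subst (t ≤_) (sym (sum-map-allPairs m n (⟦_⟧ ∘ uncurry (path₃? a b)))) t≤paths)
    in noθ (θ₃-of-paths noC4 p p-injective (path₃-sound ∘ p-paths))

  degB∖ : Fin n → Fin m → ℕ
  degB∖ j i = ∑[ a < m ] ⟦ G a j ∧ a ≢? i ⟧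

  degA∖ : Fin m → Fin n → ℕ
  degA∖ i j = ∑[ b < n ] ⟦ G i b ∧ b ≢? j ⟧

  ∑-edges-degB∖*degA∖≡∑paths :
    ∑[ i < m ] ∑[ j < n ] (⟦ G i j ⟧ * (degB∖ j i * degA∖ i j)) ≡ ∑[ a < m ] ∑[ b < n ] paths a b
  ∑-edges-degB∖*degA∖≡∑paths =
    trans (sum-cong-≗ λ i → sum-cong-≗ λ j → edge-term i j) (∑²-comm λ i j a b → ⟦ path₃? a b i j ⟧)
    where
    edge-term : ∀ i j → ⟦ G i j ⟧ * (degB∖ j i * degA∖ i j) ≡ ∑[ a < m ] ∑[ b < n ] ⟦ path₃? a b i j ⟧
    edge-term i j = begin
      ⟦ G i j ⟧ * (degB∖ j i * degA∖ i j)                                  ≡⟨ cong (⟦ G i j ⟧ *_) (∑*∑ α β) ⟩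
      ⟦ G i j ⟧ * ∑[ a < m ] ∑[ b < n ] (α a * β b)                        ≡⟨ *-distribˡ-sum ⟦ G i j ⟧ (λ a → ∑[ b < n ] (α a * β b)) ⟩
      ∑[ a < m ] (⟦ G i j ⟧ * ∑[ b < n ] (α a * β b))                      ≡⟨ sum-cong-≗ (λ a → *-distribˡ-sum ⟦ G i j ⟧ (λ b → α a * β b)) ⟩
      ∑[ a < m ] ∑[ b < n ] (⟦ G i j ⟧ * (α a * β b))                      ≡⟨ sum-cong-≗ (λ a → sum-cong-≗ (λ b → ⟦path₃?⟧ a b)) ⟨
      ∑[ a < m ] ∑[ b < n ] ⟦ path₃? a b i j ⟧                             ∎
      where
      open ≡-Reasoning
      α : Fin m → ℕ
      α a = ⟦ G a j ∧ a ≢? i ⟧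
      β : Fin n → ℕ
      β b = ⟦ G i b ∧ b ≢? j ⟧
      ⟦path₃?⟧ : ∀ a b → ⟦ path₃? a b i j ⟧ ≡ ⟦ G i j ⟧ * (α a * β b)
      ⟦path₃?⟧ a b = trans (⟦∧⟧ (G i j) _) (cong (⟦ G i j ⟧ *_) (⟦∧⟧ (G a j ∧ a ≢? i) _))

  ∑paths≤ : ¬ Contains G C4 → ∀ {t} → ¬ Contains G (θ₃ t) → ∑[ a < m ] ∑[ b < n ] paths a b ≤ m * (n * (t ∸ 1))
  ∑paths≤ noC4 {t} noθ = begin
    ∑[ a < m ] ∑[ b < n ] paths a b    ≤⟨ ∑-mono-≤ (λ a → ∑-mono-≤ (λ b → ∸-monoˡ-≤ 1 (paths<t noC4 {t} noθ a b))) ⟩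
    ∑[ a < m ] ∑[ b < n ] (t ∸ 1)      ≡⟨ sum-cong-≗ {m} (λ _ → ∑-const n (t ∸ 1)) ⟩
    ∑[ a < m ] (n * (t ∸ 1))           ≡⟨ ∑-const m (n * (t ∸ 1)) ⟩
    m * (n * (t ∸ 1))                  ∎
    where open ≤-Reasoning

  private
    e : ℕ
    e = edges G

  shareB : Fin n → ℕ
  shareB j = upperQuotient (e * e * (e + 3 * n)) (n * degB j)

  shareA : Fin m → ℕ
  shareA i = upperQuotient (e * e * (e + 3 * m)) (m * degA i)

  edge-bound : ∀ i j → ⟦ G i j ⟧ * (3 * (e * e)) ≤
                       ⟦ G i j ⟧ * (n * m * (degB∖ j i * degA∖ i j) + shareB j + shareA i)
  edge-bound i j with G i j in Gij
  ... | false = z≤n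
  ... | true  = *-monoʳ-≤ 1 $ per-edge-am-gm n m e (degB∖ j i) (degA∖ i j) (shareB j) (shareA i)
                  {{nonZeroIndex j}} {{nonZeroIndex i}}
                  (share-bound (λ a → G a j) i Gij _ n {{nonZeroIndex j}})
                  (share-bound (G i) j Gij _ m {{nonZeroIndex i}})
    where
    share-bound : ∀ {k} (f : Fin k → Bool) a → f a ≡ true → ∀ c l .{{_ : NonZero l}} →
                  c ≤ upperQuotient c (l * ∑[ b < k ] ⟦ f b ⟧) * (l * suc (∑[ b < k ] ⟦ f b ∧ b ≢? a ⟧))
    share-bound f a fa c l = ≤-trans (≤-upperQuotient c (l * sum (⟦_⟧ ∘ f)) {{m*n≢0 l _}})
      (*-monoʳ-≤ (upperQuotient c (l * sum (⟦_⟧ ∘ f))) (*-monoʳ-≤ l (∑⟦⟧≤1+∑⟦∧≢?⟧ f a)))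
      where
      instance
        deg≢0 : NonZero (sum (⟦_⟧ ∘ f))
        deg≢0 = >-nonZero (subst (λ b → ⟦ b ⟧ ≤ sum (⟦_⟧ ∘ f)) fa (≤-∑ (⟦_⟧ ∘ f) a))

  ∑-edge-bound : e * (3 * (e * e)) ≤
                 n * m * ∑[ i < m ] ∑[ j < n ] (⟦ G i j ⟧ * (degB∖ j i * degA∖ i j))
                 + ∑[ j < n ] (degB j * shareB j) + ∑[ i < m ] (degA i * shareA i)
  ∑-edge-bound = begin
    e * c                                          ≡⟨ cong (_* c) edges≡∑degA ⟩
    sum degA * c                                   ≡⟨ *-distribʳ-sum c degA ⟩
    ∑[ i < m ] (degA i * c)                        ≡⟨ sum-cong-≗ (λ i → *-distribʳ-sum c (λ j → ⟦ G i j ⟧)) ⟩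
    ∑[ i < m ] ∑[ j < n ] (⟦ G i j ⟧ * c)          ≤⟨ ∑-mono-≤ (λ i → ∑-mono-≤ (edge-bound i)) ⟩
    ∑[ i < m ] ∑[ j < n ] (⟦ G i j ⟧ * (n * m * W i j + shareB j + shareA i))
      ≡⟨ sum-cong-≗ (λ i → sum-cong-≗ (λ j → *-distribˡ-+₃ ⟦ G i j ⟧ (n * m * W i j) (shareB j) (shareA i))) ⟩
    ∑[ i < m ] ∑[ j < n ] (⟦ G i j ⟧ * (n * m * W i j) + ⟦ G i j ⟧ * shareB j + ⟦ G i j ⟧ * shareA i)
      ≡⟨ ∑²-distrib-+₃ (λ i j → ⟦ G i j ⟧ * (n * m * W i j)) (λ i j → ⟦ G i j ⟧ * shareB j) (λ i j → ⟦ G i j ⟧ * shareA i) ⟩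
    ∑[ i < m ] ∑[ j < n ] (⟦ G i j ⟧ * (n * m * W i j)) + ∑[ i < m ] ∑[ j < n ] (⟦ G i j ⟧ * shareB j)
      + ∑[ i < m ] ∑[ j < n ] (⟦ G i j ⟧ * shareA i)
      ≡⟨ cong₂ _+_ (cong₂ _+_ pull-nm regroup-B) regroup-A ⟩
    n * m * ∑[ i < m ] ∑[ j < n ] (⟦ G i j ⟧ * W i j) + ∑[ j < n ] (degB j * shareB j) + ∑[ i < m ] (degA i * shareA i) ∎
    where
    open ≤-Reasoning
    c : ℕ
    c = 3 * (e * e)
    W : Fin m → Fin n → ℕ
    W i j = degB∖ j i * degA∖ i j
    pull-nm : ∑[ i < m ] ∑[ j < n ] (⟦ G i j ⟧ * (n * m * W i j)) ≡ n * m * ∑[ i < m ] ∑[ j < n ] (⟦ G i j ⟧ * W i j)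
    pull-nm = begin-equality
      ∑[ i < m ] ∑[ j < n ] (⟦ G i j ⟧ * (n * m * W i j))   ≡⟨ sum-cong-≗ (λ i → sum-cong-≗ (λ j → x∙yz≈y∙xz ⟦ G i j ⟧ (n * m) (W i j))) ⟩
      ∑[ i < m ] ∑[ j < n ] (n * m * (⟦ G i j ⟧ * W i j))   ≡⟨ sum-cong-≗ (λ i → *-distribˡ-sum (n * m) (λ j → ⟦ G i j ⟧ * W i j)) ⟨
      ∑[ i < m ] (n * m * ∑[ j < n ] (⟦ G i j ⟧ * W i j))   ≡⟨ *-distribˡ-sum (n * m) (λ i → ∑[ j < n ] (⟦ G i j ⟧ * W i j)) ⟨
      n * m * ∑[ i < m ] ∑[ j < n ] (⟦ G i j ⟧ * W i j)     ∎
    regroup-B : ∑[ i < m ] ∑[ j < n ] (⟦ G i j ⟧ * shareB j) ≡ ∑[ j < n ] (degB j * shareB j)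
    regroup-B = trans (∑-comm (λ i j → ⟦ G i j ⟧ * shareB j))
                      (sum-cong-≗ λ j → sym (*-distribʳ-sum (shareB j) (λ i → ⟦ G i j ⟧)))
    regroup-A : ∑[ i < m ] ∑[ j < n ] (⟦ G i j ⟧ * shareA i) ≡ ∑[ i < m ] (degA i * shareA i)
    regroup-A = sum-cong-≗ λ i → sym (*-distribʳ-sum (shareA i) (λ j → ⟦ G i j ⟧))

  graph-bound : ¬ Contains G C4 → ∀ {t} → ¬ Contains G (θ₃ t) →
                e * e * e ≤ (t ∸ 1) * (n * n * (m * m)) + 3 * (e * e) * (n + m) + 2 * e
  graph-bound noC4 {t} noθ = +-cancelˡ-≤ (2 * (e * e * e)) _ _ $ begin
    2 * (e * e * e) + e * e * e
      ≡⟨ triple e ⟩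
    e * (3 * (e * e))
      ≤⟨ ∑-edge-bound ⟩
    n * m * ∑[ i < m ] ∑[ j < n ] (⟦ G i j ⟧ * (degB∖ j i * degA∖ i j))
      + ∑[ j < n ] (degB j * shareB j) + ∑[ i < m ] (degA i * shareA i)
      ≤⟨ +-mono-≤ (+-mono-≤ (*-monoʳ-≤ (n * m) ∑paths-bound) ∑shareB-bound) ∑shareA-bound ⟩
    n * m * (m * (n * (t ∸ 1))) + (e * e * (e + 3 * n) + e) + (e * e * (e + 3 * m) + e)
      ≡⟨ regroup n m (t ∸ 1) e ⟩
    2 * (e * e * e) + ((t ∸ 1) * (n * n * (m * m)) + 3 * (e * e) * (n + m) + 2 * e) ∎
    where
    open ≤-Reasoning
    triple : ∀ e → 2 * (e * e * e) + e * e * e ≡ e * (3 * (e * e))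
    triple = solve-∀
    regroup : ∀ n m T e → n * m * (m * (n * T)) + (e * e * (e + 3 * n) + e) + (e * e * (e + 3 * m) + e) ≡
                          2 * (e * e * e) + (T * (n * n * (m * m)) + 3 * (e * e) * (n + m) + 2 * e)
    regroup = solve-∀
    ∑paths-bound : ∑[ i < m ] ∑[ j < n ] (⟦ G i j ⟧ * (degB∖ j i * degA∖ i j)) ≤ m * (n * (t ∸ 1))
    ∑paths-bound = subst (_≤ m * (n * (t ∸ 1))) (sym ∑-edges-degB∖*degA∖≡∑paths) (∑paths≤ noC4 noθ)
    ∑shareB-bound : ∑[ j < n ] (degB j * shareB j) ≤ e * e * (e + 3 * n) + e
    ∑shareB-bound = subst (λ s → ∑[ j < n ] (degB j * shareB j) ≤ e * e * (e + 3 * n) + s)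
                          (trans ∑degB≡∑degA (sym edges≡∑degA))
                          (∑-weighted-upperQuotient n degB (e * e * (e + 3 * n)))
    ∑shareA-bound : ∑[ i < m ] (degA i * shareA i) ≤ e * e * (e + 3 * m) + e
    ∑shareA-bound = subst (λ s → ∑[ i < m ] (degA i * shareA i) ≤ e * e * (e + 3 * m) + s)
                          (sym edges≡∑degA)
                          (∑-weighted-upperQuotient m degA (e * e * (e + 3 * m)))

-- The exponent a > 1/2

L<U : (a : Real) → ∀ {q r} → L a q → U a r → q ℚ.< r
L<U a {q} {r} Lq Ur with ℚ.<-cmp q r
... | tri< q<r _ _ = q<r
... | tri≈ _ refl _ = contradiction Ur (disjoint a q Lq)
... | tri> _ _ r<q = contradiction Ur (disjoint a r (L-rounded₂ a r q r<q Lq))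

-- A fraction num / (1 + den) in the lower cut of a and above ½.
record FractionAboveHalf (a : Real) : Set where
  field
    num den        : ℕ
    half<fraction  : suc den < num * 2
    fraction<upper : ∀ p q → U a (ℤ.+ p ℚ./ suc q) → num * suc q < p * suc den

fractionAboveHalf : (a : Real) → L a ½ → FractionAboveHalf a
fractionAboveHalf a ½∈L with L-rounded₁ a ½ ½∈L
... | mkℚ (ℤ.+ r) d _ , ½<r/d , r/d∈L = record
  { num = r ; den = d ; half<fraction = half<fraction ; fraction<upper = fraction<upper }
  where
  half<fraction : suc d < r * 2
  half<fraction with toℚᵘ-mono-< ½<r/d
  ... | *<* lt = subst (_< r * 2) (*-identityˡ (suc d))
                   (drop‿+<+ (subst₂ ℤ._<_ (sym (pos-* 1 (suc d))) (sym (pos-* r 2)) lt))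
  fraction<upper : ∀ p q → U a (ℤ.+ p ℚ./ suc q) → r * suc q < p * suc d
  fraction<upper p q p/q∈U with <-respʳ-≃ (toℚᵘ-fromℚᵘ (mkℚᵘ (ℤ.+ p) q)) (toℚᵘ-mono-< (L<U a r/d∈L p/q∈U))
  ... | *<* lt = drop‿+<+ (subst₂ ℤ._<_ (sym (pos-* r (suc q))) (sym (pos-* p (suc d))) lt)
... | mkℚ ℤ.-[1+ _ ] _ _ , ½<r/d , _ with toℚᵘ-mono-< ½<r/d
...   | *<* ()

n^[1+s]<[M²]^s : ∀ n M r s p q → .{{_ : NonZero n}} → .{{_ : NonZero s}} →
                 s < r * 2 → r * suc q < p * s → n ^ p < M ^ suc q → n ^ suc s < (M * M) ^ s
n^[1+s]<[M²]^s n M r s p q s<2r rq<ps n^p<M^q = begin-strict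
  n ^ suc s        ≤⟨ ^-monoʳ-≤ n s<2r ⟩
  n ^ (r * 2)      ≡⟨ ^-*-assoc n r 2 ⟨
  (n ^ r) ^ 2      <⟨ ^-monoˡ-< 2 n^r<M^s ⟩
  (M ^ s) ^ 2      ≡⟨ cong (M ^ s *_) (*-identityʳ (M ^ s)) ⟩
  M ^ s * M ^ s    ≡⟨ ^-distribʳ-* M M s ⟨
  (M * M) ^ s      ∎
  where
  open ≤-Reasoning
  n^r<M^s : n ^ r < M ^ s
  n^r<M^s = ^-cancelˡ-< (suc q) $ begin-strict
    (n ^ r) ^ suc q    ≡⟨ ^-*-assoc n r (suc q) ⟩
    n ^ (r * suc q)    ≤⟨ ^-monoʳ-≤ n (<⇒≤ rq<ps) ⟩
    n ^ (p * s)        ≡⟨ ^-*-assoc n p s ⟨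
    (n ^ p) ^ s        <⟨ ^-monoˡ-< s n^p<M^q ⟩
    (M ^ suc q) ^ s    ≡⟨ ^-*-assoc M (suc q) s ⟩
    M ^ (suc q * s)    ≡⟨ cong (M ^_) (*-comm (suc q) s) ⟩
    M ^ (s * suc q)    ≡⟨ ^-*-assoc M s (suc q) ⟨
    (M ^ s) ^ suc q    ∎

k^s≤n⇒n^[1+s]<Z^s⇒k*n<Z : ∀ k n Z s → k ^ s ≤ n → n ^ suc s < Z ^ s → k * n < Z
k^s≤n⇒n^[1+s]<Z^s⇒k*n<Z k n Z s k^s≤n lt = ^-cancelˡ-< s $ begin-strict
  (k * n) ^ s      ≡⟨ ^-distribʳ-* k n s ⟩
  k ^ s * n ^ s    ≤⟨ *-monoˡ-≤ (n ^ s) k^s≤n ⟩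
  n * n ^ s        <⟨ lt ⟩
  Z ^ s            ∎
  where open ≤-Reasoning

4*k<[1+m]²⇒k<m² : ∀ k m → .{{_ : NonZero k}} → 4 * k < suc m * suc m → k < m * m
4*k<[1+m]²⇒k<m² (suc _) zero    (s≤s ())
4*k<[1+m]²⇒k<m² k       (suc m) 4k<[2+m]² = *-cancelˡ-< 4 k _ $ begin-strict
  4 * k                        <⟨ 4k<[2+m]² ⟩
  suc (suc m) * suc (suc m)    ≤⟨ m+o≡n⇒m≤n (m * (3 * m + 4)) (identity m) ⟩
  4 * (suc m * suc m)          ∎
  where
  open ≤-Reasoning
  identity : ∀ m → suc (suc m) * suc (suc m) + m * (3 * m + 4) ≡ 4 * (suc m * suc m)
  identity = solve-∀

⌊n^a⌋≤n : ∀ {a n m} → U a 1ℚ → IsFloorPow a n m → m ≤ n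
⌊n^a⌋≤n {n = n} {m} 1∈U (m^q<n^p , _) = <⇒≤ (subst₂ _<_ (*-identityʳ m) (*-identityʳ n) (m^q<n^p 1 0 1∈U))

c*n<⌊n^a⌋² : (a : Real) → L a ½ → ∀ c → ∃ λ N → ∀ n m → N ≤ n → IsFloorPow a n m → c * n < m * m
c*n<⌊n^a⌋² a ½∈L c = (4 * suc c) ^ suc den , bound
  where
  open FractionAboveHalf (fractionAboveHalf a ½∈L)
  bound : ∀ n m → (4 * suc c) ^ suc den ≤ n → IsFloorPow a n m → c * n < m * m
  bound n m N≤n (_ , p , q , p/q∈U , n^p<[1+m]^q) =
    ≤-<-trans (*-monoˡ-≤ n (n≤1+n c)) (4*k<[1+m]²⇒k<m² (suc c * n) m {{m*n≢0 (suc c) n}} 4[1+c]n<[1+m]²)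
    where
    instance
      n≢0 : NonZero n
      n≢0 = >-nonZero (≤-trans (m^n>0 (4 * suc c) (suc den)) N≤n)
    n^[2+den]<[1+m]^[2+2den] : n ^ suc (suc den) < (suc m * suc m) ^ suc den
    n^[2+den]<[1+m]^[2+2den] =
      n^[1+s]<[M²]^s n (suc m) num (suc den) p q half<fraction (fraction<upper p q p/q∈U) n^p<[1+m]^q
    4[1+c]n<[1+m]² : 4 * (suc c * n) < suc m * suc m
    4[1+c]n<[1+m]² = subst (_< suc m * suc m) (*-assoc 4 (suc c) n)
      (k^s≤n⇒n^[1+s]<Z^s⇒k*n<Z (4 * suc c) n (suc m * suc m) (suc den) N≤n n^[2+den]<[1+m]^[2+2den])

K*[7nB]³≤B*n²m² : ∀ K B n m → .{{_ : NonZero B}} → 343 * K * (B * B * B) * n < m * m →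
                   K * (7 * n * B) ^ 3 ≤ B * (n ^ 2 * m ^ 2)
K*[7nB]³≤B*n²m² K B n m cn<m² = begin
  K * (7 * n * B) ^ 3                    ≡⟨ expand K n B ⟩
  343 * K * (B * B * B) * n * (n * n)    ≤⟨ *-monoˡ-≤ (n * n) (<⇒≤ cn<m²) ⟩
  m * m * (n * n)                        ≡⟨ square-swap m n ⟩
  n ^ 2 * m ^ 2                          ≤⟨ m≤n*m (n ^ 2 * m ^ 2) B ⟩
  B * (n ^ 2 * m ^ 2)                    ∎
  where
  open ≤-Reasoning
  expand : ∀ K n B → K * (7 * n * B * (7 * n * B * (7 * n * B * 1))) ≡ 343 * K * (B * B * B) * n * (n * n)
  expand = solve-∀
  square-swap : ∀ m n → m * m * (n * n) ≡ n * (n * 1) * (m * (m * 1))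
  square-swap = solve-∀

corollary5p2 : (t : ℕ) → 2 ≤ t → (a : Real) → InHalfOne a →
    (k : ℕ) → ∃ λ N → (n m : ℕ) → N ≤ n → IsFloorPow a n m →
      (G : BipGraph m n) → ¬ Contains G C4 → ¬ Contains G (θ₃ t) →
        suc k * edges G ^ 3 ≤ (suc k * (t ∸ 1) + 1) * (n ^ 2 * m ^ 2)
corollary5p2 t 2≤t a (½∈L , 1∈U) k = N + 2 , bound
  where
  K : ℕ
  K = suc k
  B : ℕ
  B = K * (t ∸ 1) + 1
  sparse : ∃ λ N → ∀ n m → N ≤ n → IsFloorPow a n m → 343 * K * (B * B * B) * n < m * m
  sparse = c*n<⌊n^a⌋² a ½∈L (343 * K * (B * B * B))
  N : ℕ
  N = proj₁ sparse
  instance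
    t∸1≢0 : NonZero (t ∸ 1)
    t∸1≢0 = >-nonZero (∸-monoˡ-≤ 1 2≤t)
    B≢0 : NonZero B
    B≢0 = >-nonZero (m≤n+m 1 (K * (t ∸ 1)))
  bound : ∀ n m → N + 2 ≤ n → IsFloorPow a n m → (G : BipGraph m n) →
          ¬ Contains G C4 → ¬ Contains G (θ₃ t) → K * edges G ^ 3 ≤ B * (n ^ 2 * m ^ 2)
  bound n m N+2≤n m≡⌊n^a⌋ G noC4 noθ =
    absorb-lower-order K (t ∸ 1) (n ^ 2 * m ^ 2) (7 * n) (edges G)
      (lower-order-terms n m (edges G) (t ∸ 1) (⌊n^a⌋≤n {a} 1∈U m≡⌊n^a⌋) (≤-trans (m≤n+m 2 N) N+2≤n)
        (graph-bound G noC4 noθ))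
      (K*[7nB]³≤B*n²m² K B n m (proj₂ sparse n m (≤-trans (m≤m+n N 2) N+2≤n) m≡⌊n^a⌋))
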